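{- An integer $x$ is a $\tau_4$-atom if and only if $x$ is a $\tau_2$-atom.
   Context: For a positive integer $n$ and integers $x,y$, write $x\,\tau_n\,y$ if $x\equiv y \pmod n$. For a nonzero nonunit integer $x$, a $\tau_n$-factorization of $x$ is an expression $x=\lambda a_1a_2\cdots a_k$ with $\lambda\in\{1,-1\}$, each $a_i$ a nonzero nonunit integer (i.e. $a_i\neq 0,\pm1$), and $a_i\equiv a_j \pmod n$ for all $i,j$; it is proper if $k>1$. A nonzero nonunit integer $x$ is a $\tau_n$-atom if it has no proper $\tau_n$-factorization. -}

module Defs where

open import Data.Nat using (ℕ; _>_)
open import Data.Integer using (ℤ; +_; -_; _-_; _*_; 1ℤ; -1ℤ; 0ℤ)
open import Data.Integer.Divisibility using (_∣_)
open import Data.List using (List; []; _∷_; length; foldr)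
open import Data.List.Relation.Unary.All using (All)
open import Data.Product using (Σ; _×_)
open import Data.Sum using (_⊎_)
open import Relation.Binary.PropositionalEquality using (_≡_; _≢_)
open import Relation.Nullary using (¬_)

productℤ : List ℤ → ℤ
productℤ = foldr _*_ 1ℤ

_τ[_]_ : ℤ → ℕ → ℤ → Set
x τ[ n ] y = (+ n) ∣ (x - y)

NonzeroNonunit : ℤ → Set
NonzeroNonunit a = (a ≢ 0ℤ) × (a ≢ 1ℤ) × (a ≢ -1ℤ)

IsSign : ℤ → Set
IsSign λ′ = (λ′ ≡ 1ℤ) ⊎ (λ′ ≡ -1ℤ)

record τFactorization (n : ℕ) (x : ℤ) : Set where
  field
    sign     : ℤ
    factors  : List ℤ
    signOk   : IsSign sign
    nonunits : All NonzeroNonunit factors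
    related  : All (λ a → All (λ b → a τ[ n ] b) factors) factors
    equation : x ≡ sign * productℤ factors

IsProper : {n : ℕ} {x : ℤ} → τFactorization n x → Set
IsProper f = length (τFactorization.factors f) > 1

IsAtom : ℕ → ℤ → Set
IsAtom n x = NonzeroNonunit x × ¬ (Σ (τFactorization n x) IsProper)

module Submission where

-- One direction is formal: 2 divides 4, so every τ₄-factorization is a
-- τ₂-factorization with the same factors, and a τ₂-atom is a τ₄-atom.
-- For the other direction we turn a proper τ₂-factorization
-- x = s·a₁⋯a_k (k ≥ 2, all aᵢ of one parity) into a proper τ₄-one.
--   * Odd factors: each odd aᵢ is, up to sign, ≡ 1 (mod 4); changing the
--     signs of the factors only changes the global sign.
--   * Even factors: a₁a₂ is divisible by 4, so x = 2·(2y) with y ≠ 0, and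
--     2y is a nonempty product of numbers ≡ 2 (mod 4) (split off factors 2
--     until the cofactor is 2·odd); together with one more factor 2 this is
--     a proper factorization into numbers ≡ 2 (mod 4).

open import Defs
open import Data.Integer using (ℤ)
open import Function.Bundles using (_⇔_)

open import Data.Integer using (+_; -_; _-_; _+_; _*_; 1ℤ; -1ℤ; 0ℤ; ∣_∣)
open import Data.Integer.Properties
  using ( abs-*; ∣i-j∣≡∣j-i∣; ∣i∣≡0⇒i≡0; +-minus-telescope; +-identityʳ
        ; -1*i≡-i; neg-involutive; *-identityˡ; *-identityʳ; *-comm)
open import Data.Integer.DivMod using (_%_; _/_; a≡a%n+[a/n]*n; n%d<d)
import Data.Integer.Divisibility.Signed as Signed
open import Data.Integer.Tactic.RingSolver using (solve-∀)
import Data.Nat as ℕ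
import Data.Nat.Properties as ℕ
import Data.Nat.Divisibility as ℕ
open import Data.Nat using (ℕ; zero; suc; s≤s; z≤n)
open import Data.Nat.Induction using (<-wellFounded)
open import Induction.WellFounded using (Acc; acc)
open import Data.List using (List; []; _∷_; length)
open import Data.List.Relation.Unary.All as All using (All; []; _∷_)
open import Data.List.Relation.Binary.Pointwise using (Pointwise; []; _∷_; Pointwise-length)
open import Data.Product using (Σ; _×_; _,_; proj₁)
open import Data.Sum using (_⊎_; inj₁; inj₂)
open import Function.Bundles using (mk⇔)
open import Relation.Nullary.Decidable using (from-no)
open import Relation.Binary.PropositionalEquality
  using (_≡_; _≢_; refl; sym; trans; cong; cong₂; subst)

τ-sym : ∀ {n x y} → x τ[ n ] y → y τ[ n ] x
τ-sym {n} {x} {y} = subst (n ℕ.∣_) (∣i-j∣≡∣j-i∣ x y)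

τ-trans : ∀ {n x y z} → x τ[ n ] y → y τ[ n ] z → x τ[ n ] z
τ-trans {n} {x} {y} {z} x~y y~z =
  Signed.∣⇒∣ᵤ {+ n} {x - z} (subst (+ n Signed.∣_) (+-minus-telescope x y z)
    (Signed.∣m∣n⇒∣m+n (Signed.∣ᵤ⇒∣ {+ n} {x - y} x~y) (Signed.∣ᵤ⇒∣ {+ n} {y - z} y~z)))

τ-weaken : ∀ {m n x y} → m ℕ.∣ n → x τ[ n ] y → x τ[ m ] y
τ-weaken = ℕ.∣-trans

fromQuotient : ∀ {n c r} q → c ≡ q * + n + r → c τ[ n ] r
fromQuotient {n} {c} {r} q c≡qn+r =
  Signed.∣⇒∣ᵤ {+ n} {c - r} (Signed.divides q (trans (cong (_- r) c≡qn+r) (cancel (q * + n) r)))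
  where
  cancel : ∀ a b → a + b - b ≡ a
  cancel = solve-∀

toQuotient : ∀ {n c r} → c τ[ n ] r → Σ ℤ λ q → c ≡ q * + n + r
toQuotient {n} {c} {r} c~r with Signed.∣ᵤ⇒∣ {+ n} {c - r} c~r
... | Signed.divides q c-r≡qn = q , trans (restore c r) (cong (_+ r) c-r≡qn)
  where
  restore : ∀ a b → a ≡ (a - b) + b
  restore = solve-∀

parity : ∀ k → Σ ℤ λ j → (k ≡ j * + 2) ⊎ (k ≡ j * + 2 + 1ℤ)
parity k with k % + 2 | a≡a%n+[a/n]*n k (+ 2) | n%d<d k (+ 2)
... | zero        | k≡0+2q | _ = k / + 2 , inj₁ (trans k≡0+2q (drop0 (k / + 2)))
  where
  drop0 : ∀ q → + 0 + q * + 2 ≡ q * + 2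
  drop0 = solve-∀
... | suc zero    | k≡1+2q | _ = k / + 2 , inj₂ (trans k≡1+2q (swap (k / + 2)))
  where
  swap : ∀ q → + 1 + q * + 2 ≡ q * + 2 + 1ℤ
  swap = solve-∀
... | suc (suc _) | _      | s≤s (s≤s ())

ProperFactorization : ℕ → ℤ → Set
ProperFactorization n x = Σ (τFactorization n x) IsProper

congruentFactorization : ∀ {n x} r s G → IsSign s → All NonzeroNonunit G →
  All (_τ[ n ] r) G → x ≡ s * productℤ G → length G ℕ.> 1 → ProperFactorization n x
congruentFactorization r s G s± G-nonunits G~r x≡sG proper =
  record { sign = s ; factors = G ; signOk = s± ; nonunits = G-nonunits
         ; related = All.map (λ {a} a~r → All.map (λ {b} b~r →
                       τ-trans {x = a} a~r (τ-sym {x = b} b~r)) G~r) G~r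
         ; equation = x≡sG } ,
  proper

weakenFactorization : ∀ {m n x} → m ℕ.∣ n → τFactorization n x → τFactorization m x
weakenFactorization m∣n f = record
  { sign = sign ; factors = factors ; signOk = signOk ; nonunits = nonunits
  ; related = All.map (λ {a} → All.map (λ {b} → τ-weaken {x = a} {y = b} m∣n)) related
  ; equation = equation }
  where open τFactorization f

infix 4 _≈±_
_≈±_ : ℤ → ℤ → Set
a ≈± b = Σ ℤ λ t → IsSign t × a ≡ t * b

sign-* : ∀ {s t} → IsSign s → IsSign t → IsSign (s * t)
sign-* (inj₁ refl) (inj₁ refl) = inj₁ refl
sign-* (inj₁ refl) (inj₂ refl) = inj₂ refl
sign-* (inj₂ refl) (inj₁ refl) = inj₂ refl
sign-* (inj₂ refl) (inj₂ refl) = inj₁ refl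

≈±-* : ∀ {a b c d} → a ≈± b → c ≈± d → a * c ≈± b * d
≈±-* {b = b} {d = d} (s , s± , a≡sb) (t , t± , c≡td) =
  s * t , sign-* s± t± , trans (cong₂ _*_ a≡sb c≡td) (interchange s b t d)
  where
  interchange : ∀ s b t d → (s * b) * (t * d) ≡ (s * t) * (b * d)
  interchange = solve-∀

product-≈± : ∀ {F G} → Pointwise _≈±_ F G → productℤ F ≈± productℤ G
product-≈± []            = 1ℤ , inj₁ refl , refl
product-≈± (a≈b ∷ F≈G) = ≈±-* a≈b (product-≈± F≈G)

neg-nonunit : ∀ {a} → NonzeroNonunit a → NonzeroNonunit (- a)
neg-nonunit {a} (a≢0 , a≢1 , a≢-1) =
  (λ -a≡0 → a≢0 (negate -a≡0)) , (λ -a≡1 → a≢-1 (negate -a≡1)) , (λ -a≡-1 → a≢1 (negate -a≡-1))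
  where
  negate : ∀ {b} → - a ≡ b → a ≡ - b
  negate -a≡b = trans (sym (neg-involutive a)) (cong -_ -a≡b)

≈±-nonunit : ∀ {a b} → a ≈± b → NonzeroNonunit a → NonzeroNonunit b
≈±-nonunit {b = b} (_ , inj₁ refl , a≡b)  = subst NonzeroNonunit (trans a≡b (*-identityˡ b))
≈±-nonunit {b = b} (_ , inj₂ refl , a≡-b) a-nonunit =
  subst NonzeroNonunit (trans (cong -_ (trans a≡-b (-1*i≡-i b))) (neg-involutive b))
    (neg-nonunit a-nonunit)

choose : ∀ {A : Set} {R : A → A → Set} {P : A → Set} {F} →
  All (λ a → Σ A λ b → R a b × P b) F → Σ (List A) λ G → Pointwise R F G × All P G
choose []                    = [] , [] , []
choose ((b , Rab , Pb) ∷ rest) with choose rest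
... | G , F~G , PG = b ∷ G , Rab ∷ F~G , Pb ∷ PG

oddAssociate : ∀ {c} → c τ[ 2 ] 1ℤ → Σ ℤ λ c′ → c ≈± c′ × c′ τ[ 4 ] 1ℤ
oddAssociate {c} c-odd with toQuotient c-odd
... | q , c≡2q+1 with parity q
... | j , inj₁ q≡2j =
  c , (1ℤ , inj₁ refl , sym (*-identityˡ c)) ,
  fromQuotient {c = c} j (trans c≡2q+1 (trans (cong (λ u → u * + 2 + 1ℤ) q≡2j) (reassociate j)))
  where
  reassociate : ∀ j → (j * + 2) * + 2 + 1ℤ ≡ j * + 4 + 1ℤ
  reassociate = solve-∀
... | j , inj₂ q≡2j+1 =
  - c , (-1ℤ , inj₂ refl , sym (trans (-1*i≡-i (- c)) (neg-involutive c))) ,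
  fromQuotient {c = - c} (- j - 1ℤ)
    (trans (cong -_ (trans c≡2q+1 (cong (λ u → u * + 2 + 1ℤ) q≡2j+1))) (negate j))
  where
  negate : ∀ j → - ((j * + 2 + 1ℤ) * + 2 + 1ℤ) ≡ (- j - 1ℤ) * + 4 + 1ℤ
  negate = solve-∀

oddFactorization : ∀ {x} s F → IsSign s → All NonzeroNonunit F → All (_τ[ 2 ] 1ℤ) F →
  x ≡ s * productℤ F → length F ℕ.> 1 → ProperFactorization 4 x
oddFactorization {x} s F s± F-nonunits F-odd x≡sF proper
  with choose (All.zipWith normalise (F-nonunits , F-odd))
  where
  normalise : ∀ {c} → NonzeroNonunit c × c τ[ 2 ] 1ℤ →
    Σ ℤ λ c′ → c ≈± c′ × (NonzeroNonunit c′ × c′ τ[ 4 ] 1ℤ)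
  normalise (c-nonunit , c-odd) with oddAssociate c-odd
  ... | c′ , c≈c′ , c′≡1 = c′ , c≈c′ , ≈±-nonunit c≈c′ c-nonunit , c′≡1
... | G , F≈G , G-props with product-≈± F≈G | All.unzip G-props
... | t , t± , F≡tG | G-nonunits , G≡1 =
  congruentFactorization 1ℤ (s * t) G (sign-* s± t±) G-nonunits G≡1
    (trans x≡sF (trans (cong (s *_) F≡tG) (assoc s t (productℤ G))))
    (subst (1 ℕ.<_) (Pointwise-length F≈G) proper)
  where
  assoc : ∀ s t p → s * (t * p) ≡ (s * t) * p
  assoc = solve-∀

-- Integers ≡ 2 (mod 4) are nonzero nonunits: 0, 1, -1 differ from 2 by 2, 1, 3,
-- none of which is divisible by 4.
twoModFour-nonunit : ∀ {c} → c τ[ 4 ] (+ 2) → NonzeroNonunit c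
twoModFour-nonunit c~2 =
  (λ { refl → from-no (4 ℕ.∣? 2) c~2 }) ,
  (λ { refl → from-no (4 ℕ.∣? 1) c~2 }) ,
  (λ { refl → from-no (4 ℕ.∣? 3) c~2 })

halving-decreases : ∀ {w j} → w ≡ j * + 2 → j ≢ 0ℤ → ∣ j ∣ ℕ.< ∣ w ∣
halving-decreases {w} {j} w≡2j j≢0 =
  subst (∣ j ∣ ℕ.<_) (trans (sym (abs-* j (+ 2))) (cong ∣_∣ (sym w≡2j)))
    (ℕ.m<m*n ∣ j ∣ 2 {{ℕ.≢-nonZero (λ ∣j∣≡0 → j≢0 (∣i∣≡0⇒i≡0 ∣j∣≡0))}} (ℕ.n<1+n 1))

-- For w ≠ 0, 2w is a nonempty product of integers ≡ 2 (mod 4): if w is odd,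
-- 2w itself is such a number; if w = 2j, then 2w = 2 · 2j and we recurse on j.
twoModFourProduct : ∀ w → w ≢ 0ℤ →
  Σ (List ℤ) λ L → length L ℕ.≥ 1 × All (_τ[ 4 ] (+ 2)) L × w * + 2 ≡ productℤ L
twoModFourProduct w = go w (<-wellFounded ∣ w ∣)
  where
  go : ∀ w → Acc ℕ._<_ ∣ w ∣ → w ≢ 0ℤ →
    Σ (List ℤ) λ L → length L ℕ.≥ 1 × All (_τ[ 4 ] (+ 2)) L × w * + 2 ≡ productℤ L
  go w (acc smaller) w≢0 with parity w
  ... | j , inj₂ w≡2j+1 =
    w * + 2 ∷ [] , s≤s z≤n ,
    fromQuotient {c = w * + 2} j (trans (cong (_* + 2) w≡2j+1) (double-odd j)) ∷ [] ,
    sym (*-identityʳ (w * + 2))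
    where
    double-odd : ∀ j → (j * + 2 + 1ℤ) * + 2 ≡ j * + 4 + + 2
    double-odd = solve-∀
  ... | j , inj₁ w≡2j with go j (smaller (halving-decreases w≡2j j≢0)) j≢0
    where
    j≢0 : j ≢ 0ℤ
    j≢0 j≡0 = w≢0 (trans w≡2j (cong (_* + 2) j≡0))
  ... | L , _ , L~2 , 2j≡L =
    + 2 ∷ L , s≤s z≤n , 4 ℕ.∣0 ∷ L~2 ,
    trans (cong (_* + 2) w≡2j) (trans (*-comm (j * + 2) (+ 2)) (cong (+ 2 *_) 2j≡L))

-- A nonzero multiple 4y of 4 has the proper τ₄-factorization 2 · (2y), where
-- 2y is expanded by twoModFourProduct; all factors are ≡ 2 (mod 4).
fourMultipleFactorization : ∀ {x} y → y ≢ 0ℤ → x ≡ (y * + 2) * + 2 → ProperFactorization 4 x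
fourMultipleFactorization {x} y y≢0 x≡4y with twoModFourProduct y y≢0
... | L , L≥1 , L~2 , 2y≡L =
  congruentFactorization (+ 2) 1ℤ (+ 2 ∷ L) (inj₁ refl)
    (All.map twoModFour-nonunit factors~2) factors~2 x≡2L (s≤s L≥1)
  where
  factors~2 : All (_τ[ 4 ] (+ 2)) (+ 2 ∷ L)
  factors~2 = 4 ℕ.∣0 ∷ L~2
  x≡2L : x ≡ 1ℤ * (+ 2 * productℤ L)
  x≡2L = trans x≡4y (trans (*-comm (y * + 2) (+ 2))
           (trans (cong (+ 2 *_) 2y≡L) (sym (*-identityˡ (+ 2 * productℤ L)))))

-- All factors have the parity of the first one, a; if a is odd we re-sign the
-- factors, if a is even then so is the second factor b and 4 ∣ x.
τ₂⇒τ₄ : ∀ {x} → x ≢ 0ℤ → ProperFactorization 2 x → ProperFactorization 4 x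
τ₂⇒τ₄ _ (record { factors = [] } , ())
τ₂⇒τ₄ _ (record { factors = _ ∷ [] } , s≤s ())
τ₂⇒τ₄ {x} x≢0 (record { sign = s ; factors = a ∷ b ∷ rest ; signOk = s± ; nonunits = nonunits
                      ; related = a~@(_ ∷ a~b ∷ _) ∷ _ ; equation = x≡s·ab⋯ } , proper)
  with parity a
... | j , inj₂ a≡2j+1 =
  oddFactorization s (a ∷ b ∷ rest) s± nonunits
    (All.map (λ {c} a~c → τ-trans {x = c} (τ-sym {x = a} a~c) a-odd) a~) x≡s·ab⋯ proper
  where
  a-odd : a τ[ 2 ] 1ℤ
  a-odd = fromQuotient j a≡2j+1
... | j , inj₁ a≡2j
  with toQuotient {c = b} {r = 0ℤ} (τ-trans {x = b} {z = 0ℤ} (τ-sym {x = a} a~b) a-even)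
  where
  a-even : a τ[ 2 ] 0ℤ
  a-even = fromQuotient j (trans a≡2j (sym (+-identityʳ (j * + 2))))
... | q , b≡2q = fourMultipleFactorization y y≢0 x≡4y
  where
  y : ℤ
  y = s * (j * (q * productℤ rest))
  regroup : ∀ s j q p →
    s * ((j * + 2) * ((q * + 2 + 0ℤ) * p)) ≡ ((s * (j * (q * p))) * + 2) * + 2
  regroup = solve-∀
  x≡4y : x ≡ (y * + 2) * + 2
  x≡4y = trans x≡s·ab⋯ (trans (cong₂ (λ u v → s * (u * (v * productℤ rest))) a≡2j b≡2q)
           (regroup s j q (productℤ rest)))
  y≢0 : y ≢ 0ℤ
  y≢0 y≡0 = x≢0 (trans x≡4y (cong (λ u → (u * + 2) * + 2) y≡0))

theorem6 : (x : ℤ) → IsAtom 4 x ⇔ IsAtom 2 x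
theorem6 x = mk⇔ τ₄-atom⇒τ₂-atom τ₂-atom⇒τ₄-atom
  where
  τ₄-atom⇒τ₂-atom : IsAtom 4 x → IsAtom 2 x
  τ₄-atom⇒τ₂-atom (x-nonunit , no-τ₄) = x-nonunit , λ f → no-τ₄ (τ₂⇒τ₄ (proj₁ x-nonunit) f)
  τ₂-atom⇒τ₄-atom : IsAtom 2 x → IsAtom 4 x
  τ₂-atom⇒τ₄-atom (x-nonunit , no-τ₂) =
    x-nonunit , λ { (f , proper) → no-τ₂ (weakenFactorization (ℕ.divides 2 refl) f , proper) }
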